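{- Let $G$ be a simple connected graph of order $n\geq 3$, and let $V=V(G)\subseteq V(R(G))$. If $S\subseteq V$ is a maximum differential set of $R(G)$, then $|C_{R(G)}(S)|\leq \frac{|V(G)|-\mu(G)}{2}$.
   Context: $R(G)$ is the graph obtained from $G$ by adding, for each edge $e=xy\in E(G)$, a new vertex $v_e$ adjacent exactly to $x$ and $y$. For a graph $H$ and $S\subseteq V(H)$, $B_H(S)$ is the set of vertices not in $S$ adjacent to some vertex of $S$, $C_H(S)=V(H)\setminus(S\cup B_H(S))$, $\partial_H(S)=|B_H(S)|-|S|$, $\partial(H)=\max_{S\subseteq V(H)}\partial_H(S)$, and $S$ is a differential set of $H$ if $\partial_H(S)=\partial(H)$; a maximum differential set is a differential set of maximum cardinality. $\mu(G)$ denotes the maximum cardinality of a differential set of $R(G)$ contained in $V(G)$. -}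

module Defs where

open import Data.Nat using (ℕ; _<ᵇ_; _≡ᵇ_; _*_; _+_; _≤_)
open import Data.Bool using (Bool; true; false; _∧_; _∨_; not)
open import Data.Fin using (Fin; toℕ; splitAt; _↑ˡ_)
open import Data.Fin.Subset using (Subset; ∣_∣; _⊆_; _∈_)
open import Data.Vec using (Vec; tabulate; lookup; foldr)
import Data.Vec as Vec
open import Data.List using (List; length; filterᵇ; cartesianProduct; allFin)
import Data.List as List
open import Data.Product using (_×_; _,_; Σ; ∃)
open import Data.Sum using (_⊎_; inj₁; inj₂)
open import Data.Integer using (ℤ; +_; _-_; _≤_)
open import Relation.Binary.PropositionalEquality using (_≡_)

Graph : ℕ → Set
Graph n = Fin n → Fin n → Bool

IsSimple : ∀ {n} → Graph n → Set
IsSimple {n} G = (∀ (i j : Fin n) → G i j ≡ G j i) × (∀ (i : Fin n) → G i i ≡ false)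

data Reach {n} (G : Graph n) : Fin n → Fin n → Set where
  here : ∀ {i} → Reach G i i
  step : ∀ {i j k} → G i j ≡ true → Reach G j k → Reach G i k

Connected : ∀ {n} → Graph n → Set
Connected {n} G = ∀ (i j : Fin n) → Reach G i j

anyFin : ∀ {m} → (Fin m → Bool) → Bool
anyFin f = foldr _ _∨_ false (tabulate f)

B : ∀ {m} → Graph m → Subset m → Subset m
B H S = tabulate λ v → not (lookup S v) ∧ anyFin (λ u → lookup S u ∧ H u v)

C : ∀ {m} → Graph m → Subset m → Subset m
C H S = tabulate λ v → not (lookup S v) ∧ not (lookup (B H S) v)

∂ : ∀ {m} → Graph m → Subset m → ℤ
∂ H S = + ∣ B H S ∣ - + ∣ S ∣

IsDifferential : ∀ {m} → Graph m → Subset m → Set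
IsDifferential {m} H S = ∀ (T : Subset m) → ∂ H T Data.Integer.≤ ∂ H S

IsMaxDifferential : ∀ {m} → Graph m → Subset m → Set
IsMaxDifferential {m} H S =
  IsDifferential H S × (∀ (T : Subset m) → IsDifferential H T → ∣ T ∣ Data.Nat.≤ ∣ S ∣)

edges : ∀ {n} → Graph n → List (Fin n × Fin n)
edges {n} G = filterᵇ (λ { (i , j) → (toℕ i <ᵇ toℕ j) ∧ G i j })
                      (cartesianProduct (allFin n) (allFin n))

nE : ∀ {n} → Graph n → ℕ
nE G = length (edges G)

eqF : ∀ {n} → Fin n → Fin n → Bool
eqF i j = toℕ i ≡ᵇ toℕ j

incident : ∀ {n} → Fin n → Fin n × Fin n → Bool
incident i (a , b) = eqF i a ∨ eqF i b

-- R(G): vertices are Fin n (the original vertices, via _↑ˡ_) followed by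
-- one vertex v_e per edge e of G (the i-th edge of 'edges G').
R : ∀ {n} (G : Graph n) → Graph (n + nE G)
R {n} G x y with splitAt n x | splitAt n y
... | inj₁ i | inj₁ j = G i j
... | inj₁ i | inj₂ e = incident i (List.lookup (edges G) e)
... | inj₂ e | inj₁ j = incident j (List.lookup (edges G) e)
... | inj₂ _ | inj₂ _ = false

isL : ∀ {a b} → Fin a ⊎ Fin b → Bool
isL (inj₁ _) = true
isL (inj₂ _) = false

Vsub : ∀ {n} (G : Graph n) → Subset (n + nE G)
Vsub {n} G = tabulate λ x → isL (splitAt n x)

IsMu : ∀ {n} → Graph n → ℕ → Set
IsMu {n} G k =
  (Σ (Subset (n + nE G)) λ S → S ⊆ Vsub G × IsDifferential (R G) S × ∣ S ∣ ≡ k)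
  × (∀ (S : Subset (n + nE G)) → S ⊆ Vsub G → IsDifferential (R G) S → ∣ S ∣ Data.Nat.≤ k)

-- Let S ⊆ V be a maximum differential set of R(G) and x ∉ S.  The set S ∪ {x} is strictly
-- larger than S, so it cannot be differential: its boundary is no larger than that of S.  But
-- its boundary contains B(S) ∖ {x} together with every neighbour of x in C(S), hence x has at
-- most one neighbour in C(S), and none at all if x ∈ C(S).  Since G has no isolated vertex, a
-- vertex x ∈ C(S) ∩ V with neighbour y ∉ S would have the subdivision vertex of xy as a
-- neighbour in C(S); so C(S) consists of subdivision vertices only.  Counting incidences between
-- these and V, every edge contributes 2 and every vertex outside S at most 1, whence
-- 2 |C(S)| ≤ n − |S| ≤ n − μ(G), the last step because a differential set of size μ(G) exists.
module Submission where

open import Defs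
open import Data.Nat.Properties
  using ( +-0-commutativeMonoid; +-*-semiring; ≤-refl; ≤-reflexive; ≤-trans; <-irrefl; <-cmp; n≮n
        ; ≰⇒>; n≤1+n; m≤n+m; +-assoc; +-comm; +-suc; +-identityʳ; +-mono-≤; +-monoˡ-≤
        ; +-monoʳ-≤; +-cancelˡ-≤; <ᵇ⇒<; <⇒<ᵇ; ≡ᵇ⇒≡; ≡⇒≡ᵇ; module ≤-Reasoning)
open import Algebra.Properties.CommutativeMonoid.Sum +-0-commutativeMonoid
  using (sum; sum-syntax; sum-cong-≗; sum-replicate-zero; ∑-distrib-+; ∑-comm)
open import Algebra.Properties.Semiring.Sum +-*-semiring using (*-distribˡ-sum)
open import Data.Bool using (Bool; true; false; _∧_; _∨_; not; T)
open import Data.Bool.Properties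
  using (∧-conicalˡ; ∧-conicalʳ; ∧-zeroʳ; ∨-zeroʳ; ∨-identityʳ; ¬-not; not-¬; not-injective; T-∧; T-≡)
open import Data.Fin using (Fin; zero; suc; toℕ; splitAt; _↑ˡ_; _↑ʳ_; _≟_)
open import Data.Fin.Properties
  using (splitAt-↑ˡ; splitAt-↑ʳ; splitAt⁻¹-↑ˡ; splitAt⁻¹-↑ʳ; toℕ-injective; suc-injective)
open import Data.Fin.Subset using (Subset; ∣_∣; _⊆_)
import Data.Integer as ℤ
import Data.Integer.Properties as ℤ
import Data.List as List
open import Data.List.Membership.Propositional using (_∈_)
open import Data.List.Membership.Propositional.Properties
  using (∈-filter⁺; ∈-filter⁻; ∈-cartesianProduct⁺; ∈-allFin; ∈-lookup)
open import Data.List.Relation.Unary.Any using (index)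
open import Data.List.Relation.Unary.Any.Properties using (lookup-index)
open import Data.Nat using (ℕ; zero; suc; _+_; _*_; _≤_; _<_; z≤n; s≤s; _≤?_)
open import Data.Product using (_×_; _,_; proj₁; proj₂; ∃)
open import Data.Sum using (_⊎_; inj₁; inj₂; [_,_]; swap)
open import Data.Unit using (tt)
open import Data.Vec using ([]; _∷_; lookup; _[_]≔_)
open import Data.Vec.Properties
  using (lookup∘tabulate; lookup∘update; lookup∘update′; []=⇒lookup; lookup⇒[]=)
open import Function using (_∘_; Equivalence)
open import Relation.Binary using (tri<; tri≈; tri>)
open import Relation.Binary.PropositionalEquality
  using (_≡_; _≢_; refl; sym; trans; cong; cong₂; subst; module ≡-Reasoning)
open import Relation.Nullary using (¬_; yes; no; does; contradiction)
open import Relation.Nullary.Decidable using (dec-true; dec-false)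

𝟙 : Bool → ℕ
𝟙 false = 0
𝟙 true  = 1

count : ∀ {m} → (Fin m → Bool) → ℕ
count {m} f = ∑[ i < m ] 𝟙 (f i)

_⊆ᵇ_ : ∀ {m} → (Fin m → Bool) → (Fin m → Bool) → Set
f ⊆ᵇ g = ∀ i → f i ≡ true → g i ≡ true

∑-mono-≤ : ∀ {m} {f g : Fin m → ℕ} → (∀ i → f i ≤ g i) → sum f ≤ sum g
∑-mono-≤ {zero}  _   = z≤n
∑-mono-≤ {suc m} f≤g = +-mono-≤ (f≤g zero) (∑-mono-≤ (f≤g ∘ suc))

∑-↑ : ∀ n {m} (f : Fin (n + m) → ℕ) → sum f ≡ ∑[ i < n ] f (i ↑ˡ m) + ∑[ j < m ] f (n ↑ʳ j)
∑-↑ zero    f = refl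
∑-↑ (suc n) f = trans (cong (f zero +_) (∑-↑ n (f ∘ suc))) (sym (+-assoc (f zero) _ _))

∑-ones : ∀ m → ∑[ i < m ] 1 ≡ m
∑-ones zero    = refl
∑-ones (suc m) = cong suc (∑-ones m)

𝟙≤1 : ∀ b → 𝟙 b ≤ 1
𝟙≤1 false = z≤n
𝟙≤1 true  = ≤-refl

𝟙-mono : ∀ {a b} → (a ≡ true → b ≡ true) → 𝟙 a ≤ 𝟙 b
𝟙-mono {false} _ = z≤n
𝟙-mono {true}  h rewrite h refl = ≤-refl

𝟙-∨ : ∀ {a b} → (a ≡ true → b ≡ false) → 𝟙 (a ∨ b) ≡ 𝟙 a + 𝟙 b
𝟙-∨ {false} _ = refl
𝟙-∨ {true}  h rewrite h refl = refl

∣p∣≡count : ∀ {m} (p : Subset m) → ∣ p ∣ ≡ count (lookup p)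
∣p∣≡count []          = refl
∣p∣≡count (true ∷ p)  = cong suc (∣p∣≡count p)
∣p∣≡count (false ∷ p) = ∣p∣≡count p

∣p[x]≔true∣ : ∀ {m} (p : Subset m) x → lookup p x ≡ false → ∣ p [ x ]≔ true ∣ ≡ suc ∣ p ∣
∣p[x]≔true∣ (false ∷ p) zero    _  = refl
∣p[x]≔true∣ (true  ∷ p) (suc x) px = cong suc (∣p[x]≔true∣ p x px)
∣p[x]≔true∣ (false ∷ p) (suc x) px = ∣p[x]≔true∣ p x px

count-false : ∀ m → count {m} (λ _ → false) ≡ 0
count-false m = sum-replicate-zero m

count-mono : ∀ {m} {f g : Fin m → Bool} → f ⊆ᵇ g → count f ≤ count g
count-mono f⊆g = ∑-mono-≤ (λ i → 𝟙-mono (f⊆g i))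

count-∨ : ∀ {m} {f g : Fin m → Bool} → (∀ i → f i ≡ true → g i ≡ false) →
          count (λ i → f i ∨ g i) ≡ count f + count g
count-∨ {f = f} {g} disjoint =
  trans (sum-cong-≗ (λ i → 𝟙-∨ (disjoint i))) (∑-distrib-+ (𝟙 ∘ f) (𝟙 ∘ g))

count-< : ∀ {m} {f g : Fin m → Bool} → f ⊆ᵇ g → ∀ {q} → f q ≡ false → g q ≡ true →
          count f < count g
count-< f⊆g {zero} fq gq rewrite fq | gq = s≤s (count-mono (f⊆g ∘ suc))
count-< {f = f} f⊆g {suc q} fq gq =
  ≤-trans (≤-reflexive (sym (+-suc (𝟙 (f zero)) _)))
          (+-mono-≤ (𝟙-mono (f⊆g zero)) (count-< (f⊆g ∘ suc) fq gq))

count-pos : ∀ {m} {f : Fin m → Bool} {q} → f q ≡ true → 0 < count f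
count-pos {m} {f} fq =
  subst (_< count f) (count-false m) (count-< {f = λ _ → false} {g = f} (λ _ ()) refl fq)

count-except : ∀ {m} {f g : Fin m → Bool} p → (∀ i → i ≢ p → f i ≡ true → g i ≡ true) →
               count f ≤ count g + 𝟙 (f p)
count-except {f = f} {g} zero h = begin
  𝟙 (f zero) + count (f ∘ suc) ≤⟨ +-monoʳ-≤ (𝟙 (f zero)) (count-mono (λ i → h (suc i) λ ())) ⟩
  𝟙 (f zero) + count (g ∘ suc) ≤⟨ +-monoʳ-≤ (𝟙 (f zero)) (m≤n+m _ (𝟙 (g zero))) ⟩
  𝟙 (f zero) + count g         ≡⟨ +-comm (𝟙 (f zero)) _ ⟩
  count g + 𝟙 (f zero)         ∎
  where open ≤-Reasoning
count-except {f = f} {g} (suc p) h = begin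
  𝟙 (f zero) + count (f ∘ suc)                   ≤⟨ +-mono-≤ (𝟙-mono (h zero λ ())) f∘suc≤ ⟩
  𝟙 (g zero) + (count (g ∘ suc) + 𝟙 (f (suc p))) ≡⟨ +-assoc (𝟙 (g zero)) _ _ ⟨
  count g + 𝟙 (f (suc p))                        ∎
  where
    open ≤-Reasoning
    f∘suc≤ = count-except p λ i i≢p → h (suc i) (i≢p ∘ suc-injective)

two≤count : ∀ {m} {f : Fin m → Bool} {a b} → f a ≡ true → f b ≡ true → a ≢ b → 2 ≤ count f
two≤count {f = f} {a} {b} fa fb a≢b =
  ≤-trans (s≤s (count-pos {f = is-a} {a} (dec-true (a ≟ a) refl)))
          (count-< is-a⊆f (dec-false (b ≟ a) (a≢b ∘ sym)) fb)
  where
    is-a : _ → Bool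
    is-a i = does (i ≟ a)
    is-a⊆f : is-a ⊆ᵇ f
    is-a⊆f i h with i ≟ a
    ... | yes refl = fa
    is-a⊆f i () | no _

module _ (n : ℕ) {m : ℕ} {f : Fin (n + m) → Bool} where

  count-↑ʳ≤ : count (f ∘ (n ↑ʳ_)) ≤ count f
  count-↑ʳ≤ = subst (count (f ∘ (n ↑ʳ_)) ≤_) (sym (∑-↑ n (𝟙 ∘ f))) (m≤n+m _ _)

  count-↑ʳ : (∀ i → f (i ↑ˡ m) ≡ false) → count f ≡ count (f ∘ (n ↑ʳ_))
  count-↑ʳ f↑ˡ≡false = begin
    count f                                      ≡⟨ ∑-↑ n (𝟙 ∘ f) ⟩
    count (f ∘ (_↑ˡ m)) + count (f ∘ (n ↑ʳ_))    ≡⟨ cong (_+ count (f ∘ (n ↑ʳ_))) left≡0 ⟩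
    count (f ∘ (n ↑ʳ_))                          ∎
    where
      open ≡-Reasoning
      left≡0 = trans (sum-cong-≗ (cong 𝟙 ∘ f↑ˡ≡false)) (count-false n)

  count-↑ˡ : (∀ j → f (n ↑ʳ j) ≡ false) → count f ≡ count (f ∘ (_↑ˡ m))
  count-↑ˡ f↑ʳ≡false = begin
    count f                                      ≡⟨ ∑-↑ n (𝟙 ∘ f) ⟩
    count (f ∘ (_↑ˡ m)) + count (f ∘ (n ↑ʳ_))    ≡⟨ cong (count (f ∘ (_↑ˡ m)) +_) right≡0 ⟩
    count (f ∘ (_↑ˡ m)) + 0                      ≡⟨ +-identityʳ _ ⟩
    count (f ∘ (_↑ˡ m))                          ∎
    where
      open ≡-Reasoning
      right≡0 = trans (sum-cong-≗ (cong 𝟙 ∘ f↑ʳ≡false)) (count-false m)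

m-n≤o-[1+n] : ∀ {m n o} → suc m ≤ o → ℤ.+ m ℤ.- ℤ.+ n ℤ.≤ ℤ.+ o ℤ.- ℤ.+ suc n
m-n≤o-[1+n] {m} {n} {o} m<o = begin
  ℤ.+ m ℤ.- ℤ.+ n      ≡⟨ ℤ.m-n≡m⊖n m n ⟩
  m ℤ.⊖ n              ≡⟨ ℤ.[1+m]⊖[1+n]≡m⊖n m n ⟨
  suc m ℤ.⊖ suc n      ≤⟨ ℤ.⊖-monoˡ-≤ (suc n) m<o ⟩
  o ℤ.⊖ suc n          ≡⟨ ℤ.m-n≡m⊖n o (suc n) ⟨
  ℤ.+ o ℤ.- ℤ.+ suc n  ∎
  where open ℤ.≤-Reasoning

anyFin-intro : ∀ {k} (f : Fin k → Bool) u → f u ≡ true → anyFin f ≡ true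
anyFin-intro f zero    fu rewrite fu = refl
anyFin-intro f (suc u) fu =
  trans (cong (f zero ∨_) (anyFin-intro (f ∘ suc) u fu)) (∨-zeroʳ (f zero))

anyFin-elim : ∀ {k} (f : Fin k → Bool) → anyFin f ≡ true → ∃ λ u → f u ≡ true
anyFin-elim {suc k} f h with f zero in f0
... | true  = zero , f0
... | false = let u , fu = anyFin-elim (f ∘ suc) h in suc u , fu

module _ {k} (H : Graph k) (S : Subset k) where

  B-intro : ∀ {u v} → lookup S v ≡ false → lookup S u ≡ true → H u v ≡ true →
            lookup (B H S) v ≡ true
  B-intro {u} {v} Sv Su Huv = begin
    lookup (B H S) v                                      ≡⟨ lookup∘tabulate _ v ⟩
    not (lookup S v) ∧ anyFin (λ w → lookup S w ∧ H w v)  ≡⟨ cong₂ (λ a b → not a ∧ b) Sv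
                                                               (anyFin-intro _ u (cong₂ _∧_ Su Huv)) ⟩
    true                                                  ∎
    where open ≡-Reasoning

  B-elim : ∀ {v} → lookup (B H S) v ≡ true →
           lookup S v ≡ false × ∃ λ u → lookup S u ≡ true × H u v ≡ true
  B-elim {v} v∈B =
    let h = trans (sym (lookup∘tabulate _ v)) v∈B
        u , Su∧Huv = anyFin-elim _ (∧-conicalʳ _ _ h)
    in  not-injective (∧-conicalˡ _ _ h) , u , ∧-conicalˡ _ _ Su∧Huv , ∧-conicalʳ _ _ Su∧Huv

  C-intro : ∀ {v} → lookup S v ≡ false → lookup (B H S) v ≡ false → lookup (C H S) v ≡ true
  C-intro {v} Sv Bv = trans (lookup∘tabulate _ v) (cong₂ (λ a b → not a ∧ not b) Sv Bv)

  C-elim : ∀ {v} → lookup (C H S) v ≡ true → lookup S v ≡ false × lookup (B H S) v ≡ false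
  C-elim {v} v∈C = not-injective (∧-conicalˡ _ _ h) , not-injective (∧-conicalʳ _ _ h)
    where h = trans (sym (lookup∘tabulate _ v)) v∈C

  neighbour-of-S∉C : ∀ {u v} → lookup S u ≡ true → H u v ≡ true → lookup (C H S) v ≡ false
  neighbour-of-S∉C Su Huv = ¬-not λ v∈C →
    let Sv , Bv = C-elim v∈C in not-¬ Bv (B-intro Sv Su Huv)

  C-neighbour : Fin k → Fin k → Bool
  C-neighbour x v = lookup (C H S) v ∧ H x v

module _ {k} (H : Graph k) (S : Subset k) (x : Fin k) (Sx : lookup S x ≡ false) where

  private
    S+x = S [ x ]≔ true

  maxDifferential⇒∣B[S+x]∣≤∣B[S]∣ : IsMaxDifferential H S → ∣ B H S+x ∣ ≤ ∣ B H S ∣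
  maxDifferential⇒∣B[S+x]∣≤∣B[S]∣ (S-diff , S-max) with ∣ B H S+x ∣ ≤? ∣ B H S ∣
  ... | yes ≤∣B[S]∣ = ≤∣B[S]∣
  ... | no  ≰∣B[S]∣ = contradiction (subst (_≤ ∣ S ∣) ∣S+x∣≡1+∣S∣ (S-max S+x S+x-diff)) (n≮n ∣ S ∣)
    where
      ∣S+x∣≡1+∣S∣ = ∣p[x]≔true∣ S x Sx
      S+x-diff : IsDifferential H S+x
      S+x-diff U = ℤ.≤-trans (S-diff U)
        (subst (λ t → ∂ H S ℤ.≤ ℤ.+ ∣ B H S+x ∣ ℤ.- ℤ.+ t) (sym ∣S+x∣≡1+∣S∣)
               (m-n≤o-[1+n] (≰⇒> ≰∣B[S]∣)))

  ∣B[S]∣+C-neighbours≤ : H x x ≡ false →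
    ∣ B H S ∣ + count (C-neighbour H S x) ≤ ∣ B H S+x ∣ + 𝟙 (lookup (B H S) x)
  ∣B[S]∣+C-neighbours≤ Hxx = begin
    ∣ B H S ∣ + count (C-neighbour H S x)
      ≡⟨ cong (_+ count (C-neighbour H S x)) (∣p∣≡count (B H S)) ⟩
    count (lookup (B H S)) + count (C-neighbour H S x)
      ≡⟨ count-∨ disjoint ⟨
    count F
      ≤⟨ count-except x F⊆B[S+x] ⟩
    count (lookup (B H S+x)) + 𝟙 (F x)
      ≡⟨ cong₂ _+_ (sym (∣p∣≡count (B H S+x))) (cong 𝟙 Fx) ⟩
    ∣ B H S+x ∣ + 𝟙 (lookup (B H S) x) ∎
    where
      open ≤-Reasoning
      F : Fin k → Bool
      F v = lookup (B H S) v ∨ C-neighbour H S x v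
      disjoint : ∀ v → lookup (B H S) v ≡ true → C-neighbour H S x v ≡ false
      disjoint v Bv = ¬-not λ h → not-¬ (proj₂ (C-elim H S (∧-conicalˡ _ _ h))) Bv
      Fx : F x ≡ lookup (B H S) x
      Fx rewrite Hxx | ∧-zeroʳ (lookup (C H S) x) = ∨-identityʳ _
      S⊆S+x : ∀ {u} → lookup S u ≡ true → lookup S+x u ≡ true
      S⊆S+x {u} Su with u ≟ x
      ... | yes refl = lookup∘update x S true
      ... | no  u≢x  = trans (lookup∘update′ u≢x S true) Su
      F⊆B[S+x] : ∀ v → v ≢ x → F v ≡ true → lookup (B H S+x) v ≡ true
      F⊆B[S+x] v v≢x Fv with lookup (B H S) v in Bv
      ... | true  = let Sv , u , Su , Huv = B-elim H S Bv in
                    B-intro H S+x (trans (lookup∘update′ v≢x S true) Sv) (S⊆S+x Su) Huv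
      ... | false = let Sv , _ = C-elim H S (∧-conicalˡ _ _ Fv) in
                    B-intro H S+x (trans (lookup∘update′ v≢x S true) Sv)
                                  (lookup∘update x S true) (∧-conicalʳ _ _ Fv)

  maxDifferential⇒count-C-neighbour≤ : IsMaxDifferential H S → H x x ≡ false →
    count (C-neighbour H S x) ≤ 𝟙 (lookup (B H S) x)
  maxDifferential⇒count-C-neighbour≤ S-max Hxx = +-cancelˡ-≤ ∣ B H S ∣ _ _
    (≤-trans (∣B[S]∣+C-neighbours≤ Hxx) (+-monoˡ-≤ _ (maxDifferential⇒∣B[S+x]∣≤∣B[S]∣ S-max)))

data SplitView (n m : ℕ) : Fin (n + m) → Set where
  left  : (i : Fin n) → SplitView n m (i ↑ˡ m)
  right : (j : Fin m) → SplitView n m (n ↑ʳ j)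

splitView : ∀ n {m} (v : Fin (n + m)) → SplitView n m v
splitView n v with splitAt n v in eq
... | inj₁ i = subst (SplitView n _) (splitAt⁻¹-↑ˡ eq) (left i)
... | inj₂ j = subst (SplitView n _) (splitAt⁻¹-↑ʳ eq) (right j)

eqF-sound : ∀ {n} {i j : Fin n} → eqF i j ≡ true → i ≡ j
eqF-sound {i = i} {j} h = toℕ-injective (≡ᵇ⇒≡ (toℕ i) (toℕ j) (subst T (sym h) tt))

eqF-refl : ∀ {n} (i : Fin n) → eqF i i ≡ true
eqF-refl i = Equivalence.to T-≡ (≡⇒≡ᵇ (toℕ i) (toℕ i) refl)

incident-sound : ∀ {n} {w : Fin n} p → incident w p ≡ true → w ≡ proj₁ p ⊎ w ≡ proj₂ p
incident-sound {w = w} (a , b) h with eqF w a in wa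
... | true  = inj₁ (eqF-sound wa)
... | false = inj₂ (eqF-sound h)

incident-fst : ∀ {n} (a b : Fin n) → incident a (a , b) ≡ true
incident-fst a b = cong (_∨ eqF a b) (eqF-refl a)

incident-snd : ∀ {n} (a b : Fin n) → incident b (a , b) ≡ true
incident-snd a b = trans (cong (eqF b a ∨_) (eqF-refl b)) (∨-zeroʳ (eqF b a))

endpoints : ∀ {n} {x y : Fin n} {p} → p ≡ (x , y) ⊎ p ≡ (y , x) →
            incident x p ≡ true × (∀ w → incident w p ≡ true → w ≡ x ⊎ w ≡ y)
endpoints {x = x} {y} (inj₁ refl) = incident-fst x y , λ _ → incident-sound (x , y)
endpoints {x = x} {y} (inj₂ refl) = incident-snd y x , λ _ → swap ∘ incident-sound (y , x)

reach-neighbour : ∀ {n} {G : Graph n} {x y} → Reach G x y → x ≢ y → ∃ λ z → G x z ≡ true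
reach-neighbour here                 x≢x = contradiction refl x≢x
reach-neighbour (step {j = z} Gxz _) _   = z , Gxz

connected⇒no-isolated : ∀ {n} {G : Graph n} → Connected G → 2 ≤ n → ∀ x → ∃ λ y → G x y ≡ true
connected⇒no-isolated connected (s≤s (s≤s _)) zero    = reach-neighbour (connected zero (suc zero)) λ ()
connected⇒no-isolated connected (s≤s (s≤s _)) (suc x) = reach-neighbour (connected (suc x) zero) λ ()

module _ {n : ℕ} (G : Graph n) where

  private
    m = nE G

  ends : Fin m → Fin n × Fin n
  ends e = List.lookup (edges G) e

  R-↑ˡ-↑ˡ : ∀ i j → R G (i ↑ˡ m) (j ↑ˡ m) ≡ G i j
  R-↑ˡ-↑ˡ i j rewrite splitAt-↑ˡ n i m | splitAt-↑ˡ n j m = refl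

  R-↑ˡ-↑ʳ : ∀ i e → R G (i ↑ˡ m) (n ↑ʳ e) ≡ incident i (ends e)
  R-↑ˡ-↑ʳ i e rewrite splitAt-↑ˡ n i m | splitAt-↑ʳ n m e = refl

  R-↑ʳ-↑ʳ : ∀ e f → R G (n ↑ʳ e) (n ↑ʳ f) ≡ false
  R-↑ʳ-↑ʳ e f rewrite splitAt-↑ʳ n m e | splitAt-↑ʳ n m f = refl

  ∈edges⁺ : ∀ {a b} → toℕ a < toℕ b → G a b ≡ true → (a , b) ∈ edges G
  ∈edges⁺ {a} {b} a<b Gab = ∈-filter⁺ _ (∈-cartesianProduct⁺ (∈-allFin a) (∈-allFin b))
    (Equivalence.from T-∧ (<⇒<ᵇ a<b , Equivalence.from T-≡ Gab))

  ∈edges⁻ : ∀ {a b} → (a , b) ∈ edges G → toℕ a < toℕ b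
  ∈edges⁻ {a} {b} ab∈E = <ᵇ⇒< (toℕ a) (toℕ b) (proj₁ (Equivalence.to T-∧ filtered))
    where filtered = proj₂ (∈-filter⁻ _ {xs = List.cartesianProduct (List.allFin n) (List.allFin n)} ab∈E)

  ends-distinct : ∀ e → proj₁ (ends e) ≢ proj₂ (ends e)
  ends-distinct e eq = <-irrefl (cong toℕ eq) (∈edges⁻ (∈-lookup e))

  edge-index : IsSimple G → ∀ {x y} → G x y ≡ true → ∃ λ e → ends e ≡ (x , y) ⊎ ends e ≡ (y , x)
  edge-index (symmetric , irreflexive) {x} {y} Gxy with <-cmp (toℕ x) (toℕ y)
  ... | tri< x<y _ _ = let xy∈E = ∈edges⁺ x<y Gxy in
                       index xy∈E , inj₁ (sym (lookup-index xy∈E))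
  ... | tri> _ _ y<x = let yx∈E = ∈edges⁺ y<x (trans (symmetric y x) Gxy) in
                       index yx∈E , inj₂ (sym (lookup-index yx∈E))
  ... | tri≈ _ x≡y _ with toℕ-injective x≡y
  ...   | refl = contradiction (trans (sym Gxy) (irreflexive x)) λ ()

  module _ (simple : IsSimple G) {S : Subset (n + m)} (S⊆V : S ⊆ Vsub G)
           (S-max : IsMaxDifferential (R G) S) where

    edge∉S : ∀ e → lookup S (n ↑ʳ e) ≡ false
    edge∉S e = ¬-not λ e∈S → not-¬ e∉V ([]=⇒lookup (S⊆V (lookup⇒[]= (n ↑ʳ e) S e∈S)))
      where
        e∉V : lookup (Vsub G) (n ↑ʳ e) ≡ false
        e∉V = trans (lookup∘tabulate _ (n ↑ʳ e)) (cong isL (splitAt-↑ʳ n m e))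

    edge∈C : ∀ e → (∀ w → incident w (ends e) ≡ true → lookup S (w ↑ˡ m) ≡ false) →
             lookup (C (R G) S) (n ↑ʳ e) ≡ true
    edge∈C e ends∉S = C-intro (R G) S (edge∉S e) (¬-not (no-S-neighbour ∘ proj₂ ∘ B-elim (R G) S))
      where
        no-S-neighbour : ¬ ∃ λ u → lookup S u ≡ true × R G u (n ↑ʳ e) ≡ true
        no-S-neighbour (u , Su , Rue) with splitView n u
        ... | left w  = not-¬ (ends∉S w (trans (sym (R-↑ˡ-↑ʳ w e)) Rue)) Su
        ... | right f = not-¬ (R-↑ʳ-↑ʳ f e) Rue

    C-edge-at : ∀ {x y} → G x y ≡ true → lookup S (x ↑ˡ m) ≡ false → lookup S (y ↑ˡ m) ≡ false →
                ∃ λ e → C-neighbour (R G) S (x ↑ˡ m) (n ↑ʳ e) ≡ true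
    C-edge-at Gxy Sx Sy =
      let e , ends-e = edge-index simple Gxy
          x∈e , e⊆xy = endpoints ends-e
          ends∉S w w∈e = [ (λ { refl → Sx }) , (λ { refl → Sy }) ] (e⊆xy w w∈e)
      in  e , cong₂ _∧_ (edge∈C e ends∉S) (trans (R-↑ˡ-↑ʳ _ e) x∈e)

    vertex∉C : (∀ x → ∃ λ y → G x y ≡ true) → ∀ x → lookup (C (R G) S) (x ↑ˡ m) ≡ false
    vertex∉C neighbour x = ¬-not λ x∈C →
      let Sx , Bx = C-elim (R G) S x∈C
          y , Gxy = neighbour x
          Ryx = trans (R-↑ˡ-↑ˡ y x) (trans (proj₁ simple y x) Gxy)
          Sy = ¬-not λ Sy → not-¬ Bx (B-intro (R G) S Sx Sy Ryx)
          e , e∈N[x] = C-edge-at Gxy Sx Sy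
          no-C-neighbour = maxDifferential⇒count-C-neighbour≤ (R G) S (x ↑ˡ m) Sx S-max
                             (trans (R-↑ˡ-↑ˡ x x) (proj₂ simple x))
      in  <-irrefl refl (≤-trans (count-pos {f = C-neighbour (R G) S (x ↑ˡ m)} e∈N[x])
                                 (≤-trans no-C-neighbour (≤-reflexive (cong 𝟙 Bx))))

    load : Fin n → Fin m → Bool
    load x e = C-neighbour (R G) S (x ↑ˡ m) (n ↑ʳ e)

    vertex-load≤1 : ∀ x → count (load x) + 𝟙 (lookup S (x ↑ˡ m)) ≤ 1
    vertex-load≤1 x with lookup S (x ↑ˡ m) in Sx
    ... | true  = +-monoˡ-≤ 1 (≤-trans (count-mono no-load) (≤-reflexive (count-false m)))
      where
        no-load : load x ⊆ᵇ (λ _ → false)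
        no-load e h = contradiction (∧-conicalˡ _ _ h)
                        (not-¬ (neighbour-of-S∉C (R G) S Sx (∧-conicalʳ _ _ h)))
    ... | false = begin
      count (load x) + 0                    ≡⟨ +-identityʳ _ ⟩
      count (load x)                        ≤⟨ count-↑ʳ≤ n ⟩
      count (C-neighbour (R G) S (x ↑ˡ m))  ≤⟨ maxDifferential⇒count-C-neighbour≤ (R G) S (x ↑ˡ m) Sx S-max
                                                 (trans (R-↑ˡ-↑ˡ x x) (proj₂ simple x)) ⟩
      𝟙 (lookup (B (R G) S) (x ↑ˡ m))       ≤⟨ 𝟙≤1 _ ⟩
      1                                     ∎
      where open ≤-Reasoning

    edge-load≥2 : ∀ e → 2 * 𝟙 (lookup (C (R G) S) (n ↑ʳ e)) ≤ count (λ x → load x e)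
    edge-load≥2 e with lookup (C (R G) S) (n ↑ʳ e)
    ... | false = z≤n
    ... | true  = two≤count (at a (incident-fst a b)) (at b (incident-snd a b)) (ends-distinct e)
      where
        -- the with-abstraction has already reduced load w e to its adjacency conjunct
        a = proj₁ (ends e)
        b = proj₂ (ends e)
        at : ∀ w → incident w (ends e) ≡ true → R G (w ↑ˡ m) (n ↑ʳ e) ≡ true
        at w w∈e = trans (R-↑ˡ-↑ʳ w e) w∈e

    2∣C∣+∣S∣≤n : (∀ x → ∃ λ y → G x y ≡ true) → 2 * ∣ C (R G) S ∣ + ∣ S ∣ ≤ n
    2∣C∣+∣S∣≤n neighbour = begin
      2 * ∣ C (R G) S ∣ + ∣ S ∣
        ≡⟨ cong₂ (λ c s → 2 * c + s) ∣C∣≡ ∣S∣≡ ⟩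
      2 * count edge∈C? + count vertex∈S?
        ≡⟨ cong (_+ count vertex∈S?) (*-distribˡ-sum 2 (𝟙 ∘ edge∈C?)) ⟩
      ∑[ e < m ] (2 * 𝟙 (edge∈C? e)) + count vertex∈S?
        ≤⟨ +-monoˡ-≤ _ (∑-mono-≤ edge-load≥2) ⟩
      ∑[ e < m ] count (λ x → load x e) + count vertex∈S?
        ≡⟨ cong (_+ count vertex∈S?) (∑-comm (λ x e → 𝟙 (load x e))) ⟨
      ∑[ x < n ] count (load x) + count vertex∈S?
        ≡⟨ ∑-distrib-+ (count ∘ load) (𝟙 ∘ vertex∈S?) ⟨
      ∑[ x < n ] (count (load x) + 𝟙 (vertex∈S? x))
        ≤⟨ ∑-mono-≤ vertex-load≤1 ⟩
      ∑[ x < n ] 1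
        ≡⟨ ∑-ones n ⟩
      n ∎
      where
        open ≤-Reasoning
        edge∈C? : Fin m → Bool
        edge∈C? e = lookup (C (R G) S) (n ↑ʳ e)
        vertex∈S? : Fin n → Bool
        vertex∈S? x = lookup S (x ↑ˡ m)
        ∣C∣≡ : ∣ C (R G) S ∣ ≡ count edge∈C?
        ∣C∣≡ = trans (∣p∣≡count (C (R G) S)) (count-↑ʳ n (vertex∉C neighbour))
        ∣S∣≡ : ∣ S ∣ ≡ count vertex∈S?
        ∣S∣≡ = trans (∣p∣≡count S) (count-↑ˡ n edge∉S)

proposition3p2 : ∀ (n : ℕ) (G : Graph n) → IsSimple G → Connected G → 3 ≤ n →
    ∀ (mu : ℕ) → IsMu G mu →
    ∀ (S : Subset (n + nE G)) → S ⊆ Vsub G → IsMaxDifferential (R G) S →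
    2 * ∣ C (R G) S ∣ + mu ≤ n
proposition3p2 n G simple connected 3≤n mu ((S₀ , _ , S₀-diff , ∣S₀∣≡mu) , _) S S⊆V S-max = begin
  2 * ∣ C (R G) S ∣ + mu    ≤⟨ +-monoʳ-≤ _ mu≤∣S∣ ⟩
  2 * ∣ C (R G) S ∣ + ∣ S ∣ ≤⟨ 2∣C∣+∣S∣≤n G simple S⊆V S-max no-isolated ⟩
  n                         ∎
  where
    open ≤-Reasoning
    mu≤∣S∣ : mu ≤ ∣ S ∣
    mu≤∣S∣ = subst (_≤ ∣ S ∣) ∣S₀∣≡mu (proj₂ S-max S₀ S₀-diff)
    no-isolated = connected⇒no-isolated connected (≤-trans (n≤1+n 2) 3≤n)
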